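{- Work in $\mathbf{CZF}$. Full NID is equivalent to the statement that for every set $P$ of propositional letters and every game theory $T$ over $P$, the class of models of $T$ is set-generated. Likewise, finitary NID is equivalent to this statement restricted to finitary game theories, and elementary NID is equivalent to this statement restricted to elementary game theories.
   Context: A game formula over a set $P$ of propositional letters is built from letters in $P$ using set-indexed infinitary disjunctions and conjunctions, with no implications or negations. A game sequent is $\varphi\to\psi$ with $\varphi,\psi$ game formulas; a game theory is a set of game sequents. A game formula is finitary if all its conjunctions are indexed by finite sets (images of some $\{1,\dots,n\}$), and elementary if it contains no conjunctions; a finitary (elementary) game theory is a set of sequents whose hypotheses are finitary (elementary). A model is a subset $M\subseteq P$ with the evident satisfaction relation ($M\models p$ iff $p\in M$; conjunctions/disjunctions as all/some; $M\models T$ iff for each sequent the hypothesis implies the conclusion in $M$). A class $\mathcal M$ of subsets of a set $X$ is set-generated if there is a set $G\subseteq\mathcal M$ with $\forall\alpha\in\mathcal M\,\forall x\in\alpha\,\exists\beta\in G\,x\in\beta\subseteq\alpha$. A rule on $X$ is a pair $(a,b)$ of subsets of $X$, elementary if $a$ is a singleton, finitary if $a$ finite; $Y\subseteq X$ is closed under it if $a\subseteq Y$ implies $b\cap Y$ inhabited. Full NID: for every set $X$ and set $\mathcal R$ of rules on $X$, the class of subsets of $X$ closed under all rules in $\mathcal R$ is set-generated; finitary (elementary) NID restricts to finitary (elementary) rules. -}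

module Defs where

open import Level using (Level; _⊔_) renaming (suc to lsuc; zero to lzero)
open import Data.Nat using (ℕ)
open import Data.Fin using (Fin)
open import Data.Product using (Σ; _×_; _,_)
open import Relation.Binary.PropositionalEquality using (_≡_)

-- Sets of CZF are modelled by types in Set (= Set₀); subsets of X by
-- predicates X → Set; classes of subsets by predicates (X → Set) → Set.

Subset : Set → Set₁
Subset X = X → Set

_⊆_ : {X : Set} → Subset X → Subset X → Set
α ⊆ β = ∀ x → α x → β x

_⇔_ : ∀ {a b} → Set a → Set b → Set (a ⊔ b)
A ⇔ B = (A → B) × (B → A)

SetGenerated : {X : Set} → (Subset X → Set) → Set₁
SetGenerated {X} 𝓜 =
  Σ Set λ I → Σ (I → Subset X) λ G →
    ((i : I) → 𝓜 (G i)) ×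
    ((α : Subset X) → 𝓜 α → (x : X) → α x →
       Σ I λ i → G i x × (G i ⊆ α))

FinEnum : Set → Set
FinEnum I = Σ ℕ λ n → Σ (Fin n → I) λ f → (i : I) → Σ (Fin n) λ k → f k ≡ i

FiniteSubset : {X : Set} → Subset X → Set
FiniteSubset {X} a = Σ ℕ λ n → Σ (Fin n → X) λ f →
  (y : X) → a y ⇔ (Σ (Fin n) λ k → f k ≡ y)

Singleton : {X : Set} → Subset X → Set
Singleton {X} a = Σ X λ x → (y : X) → a y ⇔ (y ≡ x)

record RuleSet (X : Set) : Set₁ where
  field
    Idx  : Set
    prem : Idx → Subset X
    conc : Idx → Subset X
open RuleSet public

ClosedUnder : {X : Set} → RuleSet X → Subset X → Set
ClosedUnder {X} 𝓡 Y =
  (r : Idx 𝓡) → prem 𝓡 r ⊆ Y → Σ X λ x → conc 𝓡 r x × Y x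

ElementaryRules : {X : Set} → RuleSet X → Set
ElementaryRules 𝓡 = (r : Idx 𝓡) → Singleton (prem 𝓡 r)

FinitaryRules : {X : Set} → RuleSet X → Set
FinitaryRules 𝓡 = (r : Idx 𝓡) → FiniteSubset (prem 𝓡 r)

FullNID : Set₁
FullNID = (X : Set) (𝓡 : RuleSet X) → SetGenerated (ClosedUnder 𝓡)

FinitaryNID : Set₁
FinitaryNID = (X : Set) (𝓡 : RuleSet X) → FinitaryRules 𝓡 →
  SetGenerated (ClosedUnder 𝓡)

ElementaryNID : Set₁
ElementaryNID = (X : Set) (𝓡 : RuleSet X) → ElementaryRules 𝓡 →
  SetGenerated (ClosedUnder 𝓡)

data GameFormula (P : Set) : Set₁ where
  letter : P → GameFormula P
  ⋁      : (I : Set) → (I → GameFormula P) → GameFormula P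
  ⋀      : (I : Set) → (I → GameFormula P) → GameFormula P

data Finitary {P : Set} : GameFormula P → Set₁ where
  letter : (p : P) → Finitary (letter p)
  ⋁      : (I : Set) (φ : I → GameFormula P) →
           ((i : I) → Finitary (φ i)) → Finitary (⋁ I φ)
  ⋀      : (I : Set) (φ : I → GameFormula P) → FinEnum I →
           ((i : I) → Finitary (φ i)) → Finitary (⋀ I φ)

data Elementary {P : Set} : GameFormula P → Set₁ where
  letter : (p : P) → Elementary (letter p)
  ⋁      : (I : Set) (φ : I → GameFormula P) →
           ((i : I) → Elementary (φ i)) → Elementary (⋁ I φ)

record GameSequent (P : Set) : Set₁ where
  constructor _⇒_
  field
    hyp  : GameFormula P
    conc : GameFormula P
open GameSequent public

record GameTheory (P : Set) : Set₁ where
  field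
    Ax  : Set
    seq : Ax → GameSequent P
open GameTheory public

_⊨_ : {P : Set} → Subset P → GameFormula P → Set
M ⊨ letter p = M p
M ⊨ ⋁ I φ = Σ I λ i → M ⊨ φ i
M ⊨ ⋀ I φ = (i : I) → M ⊨ φ i

Model : {P : Set} → GameTheory P → Subset P → Set
Model T M = (s : Ax T) → M ⊨ hyp (seq T s) → M ⊨ GameSequent.conc (seq T s)

FinitaryTheory : {P : Set} → GameTheory P → Set₁
FinitaryTheory T = (s : Ax T) → Finitary (hyp (seq T s))

ElementaryTheory : {P : Set} → GameTheory P → Set₁
ElementaryTheory T = (s : Ax T) → Elementary (hyp (seq T s))

GameModelsSetGenerated : Set₁
GameModelsSetGenerated = (P : Set) (T : GameTheory P) → SetGenerated (Model T)

FinitaryGameModelsSetGenerated : Set₁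
FinitaryGameModelsSetGenerated = (P : Set) (T : GameTheory P) →
  FinitaryTheory T → SetGenerated (Model T)

ElementaryGameModelsSetGenerated : Set₁
ElementaryGameModelsSetGenerated = (P : Set) (T : GameTheory P) →
  ElementaryTheory T → SetGenerated (Model T)

-- A rule (a, b) is the game sequent ⋀a → ⋁b, so the sets closed under a rule
-- set are the models of a game theory whose hypotheses are as simple as the
-- premises. Conversely, a game theory over P is simulated by rules on P enlarged
-- by one letter for each occurrence of a subformula: for occurrences in a
-- hypothesis the rules say that the letter holds when the subformula does, for
-- those in a conclusion that the subformula holds when the letter does, and one
-- rule per sequent links the two roots. Every model extends to a closed set by
-- labelling each occurrence with its truth value, and every closed set restricts
-- to a model. All premises are single letters except those of conjunctions in
-- hypotheses, which are the (finite, if the conjunction is) sets of letters of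
-- the conjuncts.
module Submission where

open import Defs
open import Data.Empty using (⊥)
open import Data.Fin using (Fin; zero)
open import Data.Nat using (ℕ)
open import Data.Product using (_×_; Σ; _,_; proj₁; proj₂)
open import Data.Sum using (_⊎_; inj₁; inj₂)
open import Data.Unit using (⊤; tt)
open import Function using (_∘_; id)
open import Relation.Binary.PropositionalEquality using (_≡_; refl; sym; trans; cong)

⇔-refl : {A : Set} → A ⇔ A
⇔-refl = id , id

SetGenerated-transfer :
  {P X : Set} {𝓜 : Subset P → Set} {𝓝 : Subset X → Set}
  (f : P → X) (extend : Subset P → Subset X) →
  ((N : Subset X) → 𝓝 N → 𝓜 (N ∘ f)) →
  ((M : Subset P) → 𝓜 M → 𝓝 (extend M)) →
  ((M : Subset P) (p : P) → extend M (f p) ⇔ M p) →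
  SetGenerated 𝓝 → SetGenerated 𝓜
SetGenerated-transfer {P} {𝓜 = 𝓜} f extend restrict-∈ extend-∈ agree
                      (I , G , G∈𝓝 , generates) =
  I , (λ i → G i ∘ f) , (λ i → restrict-∈ (G i) (G∈𝓝 i)) , generates′
  where
  generates′ : (α : Subset P) → 𝓜 α → (x : P) → α x → Σ I λ i → G i (f x) × ((G i ∘ f) ⊆ α)
  generates′ α α∈𝓜 x αx =
    let i , Gi-fx , Gi⊆ =
          generates (extend α) (extend-∈ α α∈𝓜) (f x) (proj₂ (agree α x) αx)
    in  i , Gi-fx , λ p Gi-fp → proj₁ (agree α p) (Gi⊆ (f p) Gi-fp)

Image : {X I : Set} → (I → X) → Subset X
Image {I = I} f y = Σ I λ i → f i ≡ y

FinEnum-Fin : (n : ℕ) → FinEnum (Fin n)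
FinEnum-Fin n = n , id , λ k → k , refl

FiniteSubset-Image : {X I : Set} {f : I → X} → FinEnum I → FiniteSubset (Image f)
FiniteSubset-Image {f = f} (n , g , g-surjective) =
  n , f ∘ g , λ y → to y , λ { (k , fgk≡y) → g k , fgk≡y }
  where
  to : ∀ y → Image f y → Σ (Fin n) λ k → f (g k) ≡ y
  to y (i , fi≡y) = let k , gk≡i = g-surjective i in k , trans (cong f gk≡i) fi≡y

Singleton-Image-⊤ : {X : Set} {x : X} → Singleton (Image {I = ⊤} λ _ → x)
Singleton-Image-⊤ {x = x} = x , λ y → (λ { (_ , x≡y) → sym x≡y }) , (λ y≡x → tt , sym y≡x)

Singleton⇒FiniteSubset : {X : Set} {a : Subset X} → Singleton a → FiniteSubset a
Singleton⇒FiniteSubset (x , a≐x) = 1 , (λ _ → x) , λ y →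
  (λ ay → zero , sym (proj₁ (a≐x y) ay)) , λ { (_ , x≡y) → proj₂ (a≐x y) (sym x≡y) }

module _ {X : Set} where

  _⟹_ : {I J : Set} → (I → X) → (J → X) → RuleSet X
  f ⟹ g = record { Idx = ⊤ ; prem = λ _ → Image f ; conc = λ _ → Image g }

  _⟶_ : X → X → RuleSet X
  x ⟶ y = (λ (_ : ⊤) → x) ⟹ (λ (_ : ⊤) → y)

  _∪ᴿ_ : RuleSet X → RuleSet X → RuleSet X
  𝓡 ∪ᴿ 𝓢 = record
    { Idx  = Idx 𝓡 ⊎ Idx 𝓢
    ; prem = λ { (inj₁ r) → prem 𝓡 r ; (inj₂ r) → prem 𝓢 r }
    ; conc = λ { (inj₁ r) → conc 𝓡 r ; (inj₂ r) → conc 𝓢 r }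
    }

  ⋃ᴿ : (J : Set) → (J → RuleSet X) → RuleSet X
  ⋃ᴿ J 𝓡 = record
    { Idx  = Σ J (Idx ∘ 𝓡)
    ; prem = λ (j , r) → prem (𝓡 j) r
    ; conc = λ (j , r) → conc (𝓡 j) r
    }

  closed-⟹ : {I J : Set} {f : I → X} {g : J → X} {Y : Subset X} →
    ClosedUnder (f ⟹ g) Y ⇔ ((∀ i → Y (f i)) → Σ J λ j → Y (g j))
  closed-⟹ {f = f} {g} {Y} = to , from
    where
    to : ClosedUnder (f ⟹ g) Y → (∀ i → Y (f i)) → Σ _ λ j → Y (g j)
    to closed Yf with closed tt (λ { _ (i , refl) → Yf i })
    ... | _ , (j , refl) , Ygj = j , Ygj
    from : ((∀ i → Y (f i)) → Σ _ λ j → Y (g j)) → ClosedUnder (f ⟹ g) Y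
    from h _ Image-f⊆Y = let j , Ygj = h (λ i → Image-f⊆Y (f i) (i , refl)) in g j , (j , refl) , Ygj

  closed-⟶ : {x y : X} {Y : Subset X} → ClosedUnder (x ⟶ y) Y ⇔ (Y x → Y y)
  closed-⟶ = (λ closed Yx → proj₂ (proj₁ closed-⟹ closed λ _ → Yx))
           , (λ h → proj₂ closed-⟹ λ Yx → tt , h (Yx tt))

  closed-∪ : {𝓡 𝓢 : RuleSet X} {Y : Subset X} →
    ClosedUnder (𝓡 ∪ᴿ 𝓢) Y ⇔ (ClosedUnder 𝓡 Y × ClosedUnder 𝓢 Y)
  closed-∪ = (λ closed → closed ∘ inj₁ , closed ∘ inj₂)
           , λ { (c , d) (inj₁ r) → c r ; (c , d) (inj₂ r) → d r }

  closed-⋃ : {J : Set} {𝓡 : J → RuleSet X} {Y : Subset X} →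
    ClosedUnder (⋃ᴿ J 𝓡) Y ⇔ ((j : J) → ClosedUnder (𝓡 j) Y)
  closed-⋃ = (λ closed j r → closed (j , r)) , (λ closed (j , r) → closed j r)

module _ {X : Set} where

  Expresses : GameFormula X → Subset X → Set₁
  Expresses φ a = (M : Subset X) → (M ⊨ φ) ⇔ (a ⊆ M)

  conjunction-expresses : {I : Set} {f : I → X} {a : Subset X} →
    (∀ y → a y ⇔ Image f y) → Expresses (⋀ I (letter ∘ f)) a
  conjunction-expresses {f = f} {a} a≐f M = to , from
    where
    to : (∀ i → M (f i)) → a ⊆ M
    to Mf y ay with proj₁ (a≐f y) ay
    ... | i , refl = Mf i
    from : a ⊆ M → ∀ i → M (f i)
    from a⊆M i = a⊆M (f i) (proj₂ (a≐f (f i)) (i , refl))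

  letter-expresses : {a : Subset X} ((x , _) : Singleton a) → Expresses (letter x) a
  letter-expresses {a} (x , a≐x) M = to , from
    where
    to : M x → a ⊆ M
    to Mx y ay with proj₁ (a≐x y) ay
    ... | refl = Mx
    from : a ⊆ M → M x
    from a⊆M = a⊆M x (proj₂ (a≐x x) refl)

  premise-conjunction : (a : Subset X) → GameFormula X
  premise-conjunction a = ⋀ (Σ X a) (letter ∘ proj₁)

  premise-conjunction-expresses : (a : Subset X) → Expresses (premise-conjunction a) a
  premise-conjunction-expresses a =
    conjunction-expresses λ y → (λ ay → (y , ay) , refl) , λ { ((_ , ay) , refl) → ay }

  rulesTheory : (𝓡 : RuleSet X) → (Idx 𝓡 → GameFormula X) → GameTheory X
  rulesTheory 𝓡 φ = record
    { Ax  = Idx 𝓡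
    ; seq = λ r → φ r ⇒ ⋁ (Σ X (conc 𝓡 r)) (letter ∘ proj₁)
    }

  models-rulesTheory : (𝓡 : RuleSet X) (φ : Idx 𝓡 → GameFormula X) →
    ((r : Idx 𝓡) → Expresses (φ r) (prem 𝓡 r)) →
    (M : Subset X) → Model (rulesTheory 𝓡 φ) M ⇔ ClosedUnder 𝓡 M
  models-rulesTheory 𝓡 φ φ-expresses M =
    (λ model r a⊆M → let (y , by) , My = model r (proj₂ (φ-expresses r M) a⊆M) in y , by , My) ,
    (λ closed r Mφ → let y , by , My = closed r (proj₁ (φ-expresses r M) Mφ) in (y , by) , My)

  closedSets-setGenerated : (𝓡 : RuleSet X) (φ : Idx 𝓡 → GameFormula X) →
    ((r : Idx 𝓡) → Expresses (φ r) (prem 𝓡 r)) →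
    SetGenerated (Model (rulesTheory 𝓡 φ)) → SetGenerated (ClosedUnder 𝓡)
  closedSets-setGenerated 𝓡 φ φ-expresses = SetGenerated-transfer id id
    (λ M → proj₁ (models-rulesTheory 𝓡 φ φ-expresses M))
    (λ M → proj₂ (models-rulesTheory 𝓡 φ φ-expresses M))
    (λ _ _ → ⇔-refl)

module _ {P : Set} where

  Children : GameFormula P → Set
  Children (letter _) = ⊥
  Children (⋁ I φ)    = Σ I λ i → ⊤ ⊎ Children (φ i)
  Children (⋀ I φ)    = Σ I λ i → ⊤ ⊎ Children (φ i)

  Occurrence : GameFormula P → Set
  Occurrence ψ = ⊤ ⊎ Children ψ

  pattern here    = inj₁ tt
  pattern _▸_ i q = inj₂ (i , q)

  _at_ : (ψ : GameFormula P) → Occurrence ψ → GameFormula P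
  ψ       at here    = ψ
  (⋁ I φ) at (i ▸ q) = φ i at q
  (⋀ I φ) at (i ▸ q) = φ i at q

-- In introRules ψ e and elimRules ψ e, the letter e q of X stands for the
-- occurrence q of a subformula of ψ.
module Unfolding {P X : Set} (atom : P → X) where

  introRules : (ψ : GameFormula P) → (Occurrence ψ → X) → RuleSet X
  introRules (letter p) e = atom p ⟶ e here
  introRules (⋁ I φ) e = ⋃ᴿ I λ i →
    (e (i ▸ here) ⟶ e here) ∪ᴿ introRules (φ i) (λ q → e (i ▸ q))
  introRules (⋀ I φ) e =
    ((λ i → e (i ▸ here)) ⟹ (λ (_ : ⊤) → e here)) ∪ᴿ
    ⋃ᴿ I (λ i → introRules (φ i) (λ q → e (i ▸ q)))

  elimRules : (ψ : GameFormula P) → (Occurrence ψ → X) → RuleSet X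
  elimRules (letter p) e = e here ⟶ atom p
  elimRules (⋁ I φ) e =
    ((λ (_ : ⊤) → e here) ⟹ (λ i → e (i ▸ here))) ∪ᴿ
    ⋃ᴿ I (λ i → elimRules (φ i) (λ q → e (i ▸ q)))
  elimRules (⋀ I φ) e = ⋃ᴿ I λ i →
    (e here ⟶ e (i ▸ here)) ∪ᴿ elimRules (φ i) (λ q → e (i ▸ q))

  LabelsTruth : Subset X → (ψ : GameFormula P) → (Occurrence ψ → X) → Set
  LabelsTruth Y ψ e = (q : Occurrence ψ) → Y (e q) ⇔ ((Y ∘ atom) ⊨ (ψ at q))

  module _ {Y : Subset X} where

    introRules-sound : (ψ : GameFormula P) (e : Occurrence ψ → X) →
      ClosedUnder (introRules ψ e) Y → (Y ∘ atom) ⊨ ψ → Y (e here)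
    introRules-sound (letter p) e closed = proj₁ closed-⟶ closed
    introRules-sound (⋁ I φ) e closed (i , Yφi) =
      let top , below = proj₁ closed-∪ (proj₁ closed-⋃ closed i)
      in  proj₁ closed-⟶ top (introRules-sound (φ i) _ below Yφi)
    introRules-sound (⋀ I φ) e closed Yφ =
      let top , below = proj₁ closed-∪ closed
      in  proj₂ (proj₁ closed-⟹ top λ i →
            introRules-sound (φ i) _ (proj₁ closed-⋃ below i) (Yφ i))

    elimRules-sound : (ψ : GameFormula P) (e : Occurrence ψ → X) →
      ClosedUnder (elimRules ψ e) Y → Y (e here) → (Y ∘ atom) ⊨ ψ
    elimRules-sound (letter p) e closed = proj₁ closed-⟶ closed
    elimRules-sound (⋁ I φ) e closed Ye =
      let top , below = proj₁ closed-∪ closed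
          i , Yei     = proj₁ closed-⟹ top (λ _ → Ye)
      in  i , elimRules-sound (φ i) _ (proj₁ closed-⋃ below i) Yei
    elimRules-sound (⋀ I φ) e closed Ye i =
      let top , below = proj₁ closed-∪ (proj₁ closed-⋃ closed i)
      in  elimRules-sound (φ i) _ below (proj₁ closed-⟶ top Ye)

    introRules-closed : (ψ : GameFormula P) (e : Occurrence ψ → X) →
      LabelsTruth Y ψ e → ClosedUnder (introRules ψ e) Y
    introRules-closed (letter p) e labels = proj₂ closed-⟶ (proj₂ (labels here))
    introRules-closed (⋁ I φ) e labels = proj₂ closed-⋃ λ i → proj₂ closed-∪
      ( proj₂ closed-⟶ (λ Yei → proj₂ (labels here) (i , proj₁ (labels (i ▸ here)) Yei))
      , introRules-closed (φ i) _ (λ q → labels (i ▸ q)) )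
    introRules-closed (⋀ I φ) e labels = proj₂ closed-∪
      ( proj₂ closed-⟹ (λ Ye → tt , proj₂ (labels here) λ i → proj₁ (labels (i ▸ here)) (Ye i))
      , proj₂ closed-⋃ λ i → introRules-closed (φ i) _ (λ q → labels (i ▸ q)) )

    elimRules-closed : (ψ : GameFormula P) (e : Occurrence ψ → X) →
      LabelsTruth Y ψ e → ClosedUnder (elimRules ψ e) Y
    elimRules-closed (letter p) e labels = proj₂ closed-⟶ (proj₁ (labels here))
    elimRules-closed (⋁ I φ) e labels = proj₂ closed-∪
      ( proj₂ closed-⟹ (λ Ye → let i , Yφi = proj₁ (labels here) (Ye tt)
                               in  i , proj₂ (labels (i ▸ here)) Yφi)
      , proj₂ closed-⋃ λ i → elimRules-closed (φ i) _ (λ q → labels (i ▸ q)) )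
    elimRules-closed (⋀ I φ) e labels = proj₂ closed-⋃ λ i → proj₂ closed-∪
      ( proj₂ closed-⟶ (λ Ye → proj₂ (labels (i ▸ here)) (proj₁ (labels here) Ye i))
      , elimRules-closed (φ i) _ (λ q → labels (i ▸ q)) )

  introRules-elementary : (ψ : GameFormula P) (e : Occurrence ψ → X) →
    Elementary ψ → ElementaryRules (introRules ψ e)
  introRules-elementary (letter p) e _ _                      = Singleton-Image-⊤
  introRules-elementary (⋁ I φ) e _ (i , inj₁ _)              = Singleton-Image-⊤
  introRules-elementary (⋁ I φ) e (⋁ _ _ φ-elem) (i , inj₂ r) = introRules-elementary (φ i) _ (φ-elem i) r

  introRules-finitary : (ψ : GameFormula P) (e : Occurrence ψ → X) →
    Finitary ψ → FinitaryRules (introRules ψ e)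
  introRules-finitary (letter p) e _ _                         = Singleton⇒FiniteSubset Singleton-Image-⊤
  introRules-finitary (⋁ I φ) e _ (i , inj₁ _)                 = Singleton⇒FiniteSubset Singleton-Image-⊤
  introRules-finitary (⋁ I φ) e (⋁ _ _ φ-fin) (i , inj₂ r)     = introRules-finitary (φ i) _ (φ-fin i) r
  introRules-finitary (⋀ I φ) e (⋀ _ _ I-fin _) (inj₁ _)       = FiniteSubset-Image I-fin
  introRules-finitary (⋀ I φ) e (⋀ _ _ _ φ-fin) (inj₂ (i , r)) = introRules-finitary (φ i) _ (φ-fin i) r

  elimRules-elementary : (ψ : GameFormula P) (e : Occurrence ψ → X) → ElementaryRules (elimRules ψ e)
  elimRules-elementary (letter p) e _           = Singleton-Image-⊤
  elimRules-elementary (⋁ I φ) e (inj₁ _)       = Singleton-Image-⊤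
  elimRules-elementary (⋁ I φ) e (inj₂ (i , r)) = elimRules-elementary (φ i) _ r
  elimRules-elementary (⋀ I φ) e (i , inj₁ _)   = Singleton-Image-⊤
  elimRules-elementary (⋀ I φ) e (i , inj₂ r)   = elimRules-elementary (φ i) _ r

module TheoryRules {P : Set} (T : GameTheory P) where

  hypothesis conclusion : Ax T → GameFormula P
  hypothesis s = hyp (seq T s)
  conclusion s = GameSequent.conc (seq T s)

  Letter : Set
  Letter = P ⊎ Σ (Ax T) λ s → Occurrence (hypothesis s) ⊎ Occurrence (conclusion s)

  hypothesisLetter : (s : Ax T) → Occurrence (hypothesis s) → Letter
  hypothesisLetter s q = inj₂ (s , inj₁ q)

  conclusionLetter : (s : Ax T) → Occurrence (conclusion s) → Letter
  conclusionLetter s q = inj₂ (s , inj₂ q)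

  open Unfolding {X = Letter} inj₁

  theoryRules : RuleSet Letter
  theoryRules = ⋃ᴿ (Ax T) λ s →
    introRules (hypothesis s) (hypothesisLetter s) ∪ᴿ
    (elimRules (conclusion s) (conclusionLetter s) ∪ᴿ
     (hypothesisLetter s here ⟶ conclusionLetter s here))

  extend : Subset P → Subset Letter
  extend M (inj₁ p)            = M p
  extend M (inj₂ (s , inj₁ q)) = M ⊨ (hypothesis s at q)
  extend M (inj₂ (s , inj₂ q)) = M ⊨ (conclusion s at q)

  extend-closed : (M : Subset P) → Model T M → ClosedUnder theoryRules (extend M)
  extend-closed M model = proj₂ closed-⋃ λ s → proj₂ closed-∪
    ( introRules-closed (hypothesis s) _ (λ _ → ⇔-refl)
    , proj₂ closed-∪ (elimRules-closed (conclusion s) _ (λ _ → ⇔-refl) , proj₂ closed-⟶ (model s)) )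

  restrict-model : (Y : Subset Letter) → ClosedUnder theoryRules Y → Model T (Y ∘ inj₁)
  restrict-model Y closed s Yhyp =
    let intro , rest = proj₁ closed-∪ (proj₁ closed-⋃ closed s)
        elim , axiom = proj₁ closed-∪ rest
    in  elimRules-sound (conclusion s) _ elim
          (proj₁ closed-⟶ axiom (introRules-sound (hypothesis s) _ intro Yhyp))

  models-setGenerated : SetGenerated (ClosedUnder theoryRules) → SetGenerated (Model T)
  models-setGenerated = SetGenerated-transfer inj₁ extend restrict-model extend-closed (λ _ _ → ⇔-refl)

  theoryRules-elementary : ElementaryTheory T → ElementaryRules theoryRules
  theoryRules-elementary hyp-elem (s , inj₁ r)        = introRules-elementary (hypothesis s) _ (hyp-elem s) r
  theoryRules-elementary _        (s , inj₂ (inj₁ r)) = elimRules-elementary (conclusion s) _ r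
  theoryRules-elementary _        (s , inj₂ (inj₂ _)) = Singleton-Image-⊤

  theoryRules-finitary : FinitaryTheory T → FinitaryRules theoryRules
  theoryRules-finitary hyp-fin (s , inj₁ r)        = introRules-finitary (hypothesis s) _ (hyp-fin s) r
  theoryRules-finitary _       (s , inj₂ (inj₁ r)) =
    Singleton⇒FiniteSubset (elimRules-elementary (conclusion s) _ r)
  theoryRules-finitary _       (s , inj₂ (inj₂ _)) = Singleton⇒FiniteSubset Singleton-Image-⊤

open TheoryRules using (theoryRules; models-setGenerated; theoryRules-finitary; theoryRules-elementary)

FullNID⇒GameModelsSetGenerated : FullNID → GameModelsSetGenerated
FullNID⇒GameModelsSetGenerated nid P T = models-setGenerated T (nid _ (theoryRules T))

GameModelsSetGenerated⇒FullNID : GameModelsSetGenerated → FullNID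
GameModelsSetGenerated⇒FullNID games X 𝓡 =
  closedSets-setGenerated 𝓡 φ (premise-conjunction-expresses ∘ prem 𝓡) (games X (rulesTheory 𝓡 φ))
  where
  φ : Idx 𝓡 → GameFormula X
  φ = premise-conjunction ∘ prem 𝓡

FinitaryNID⇒FinitaryGameModelsSetGenerated : FinitaryNID → FinitaryGameModelsSetGenerated
FinitaryNID⇒FinitaryGameModelsSetGenerated nid P T finitary =
  models-setGenerated T (nid _ (theoryRules T) (theoryRules-finitary T finitary))

FinitaryGameModelsSetGenerated⇒FinitaryNID : FinitaryGameModelsSetGenerated → FinitaryNID
FinitaryGameModelsSetGenerated⇒FinitaryNID games X 𝓡 finitary =
  closedSets-setGenerated 𝓡 φ (λ r → conjunction-expresses (proj₂ (proj₂ (finitary r))))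
    (games X (rulesTheory 𝓡 φ) λ r → ⋀ _ _ (FinEnum-Fin _) λ _ → letter _)
  where
  φ : Idx 𝓡 → GameFormula X
  φ r = let n , f , _ = finitary r in ⋀ (Fin n) (letter ∘ f)

ElementaryNID⇒ElementaryGameModelsSetGenerated : ElementaryNID → ElementaryGameModelsSetGenerated
ElementaryNID⇒ElementaryGameModelsSetGenerated nid P T elementary =
  models-setGenerated T (nid _ (theoryRules T) (theoryRules-elementary T elementary))

ElementaryGameModelsSetGenerated⇒ElementaryNID : ElementaryGameModelsSetGenerated → ElementaryNID
ElementaryGameModelsSetGenerated⇒ElementaryNID games X 𝓡 elementary =
  closedSets-setGenerated 𝓡 φ (letter-expresses ∘ elementary)
    (games X (rulesTheory 𝓡 φ) λ _ → letter _)
  where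
  φ : Idx 𝓡 → GameFormula X
  φ r = letter (proj₁ (elementary r))

corollary4p4 : (FullNID ⇔ GameModelsSetGenerated)
    × (FinitaryNID ⇔ FinitaryGameModelsSetGenerated)
    × (ElementaryNID ⇔ ElementaryGameModelsSetGenerated)
corollary4p4 =
  ( FullNID⇒GameModelsSetGenerated , GameModelsSetGenerated⇒FullNID )
  , ( FinitaryNID⇒FinitaryGameModelsSetGenerated , FinitaryGameModelsSetGenerated⇒FinitaryNID )
  , ( ElementaryNID⇒ElementaryGameModelsSetGenerated , ElementaryGameModelsSetGenerated⇒ElementaryNID )
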